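{- Let $A=\{a_1,\ldots,a_m\}$ be a finite set with $|A|=m$ and let $\mathbb{F}$ be a finite field of odd characteristic. For each $a\in A$ let $c_a\in\mathbb{F}$ be nonzero. Define $T:A\times A\times A\to\mathbb{F}$ by $$T(x,y,z)=\sum_{a\in A}c_a\bigl(\delta_a(y)\delta_a(z)+(1-\delta_a(y))(1-\delta_a(z))\bigr)\delta_a(x).$$ Then the rank of $T$ is at least $m-2$.
   Context: For $a\in A$, $\delta_a:A\to\mathbb{F}$ is the Kronecker function: $\delta_a(x)=1$ if $x=a$ and $\delta_a(x)=0$ otherwise. A function $T:A^3\to\mathbb{F}$ of variables $x_1,x_2,x_3$ is rank one if it is nonzero and of the form $T(x_1,x_2,x_3)=f(x_i)\,g(x_j,x_k)$ for some $i\in\{1,2,3\}$, where $\{j,k\}=\{1,2,3\}\setminus\{i\}$, and some functions $f:A\to\mathbb{F}$, $g:A^2\to\mathbb{F}$. The rank of a general $T:A^3\to\mathbb{F}$ is the least number of rank one functions needed to express $T$ as a linear combination (the zero function has rank $0$). -}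

module Defs where

open import Level using (Level; _⊔_)
open import Algebra.Bundles using (CommutativeRing)
open import Data.Nat using (ℕ; zero; suc; _<_; _%_)
open import Data.Fin using (Fin; _≟_)
open import Data.Product using (Σ; ∃; _×_; _,_)
open import Data.Sum using (_⊎_)
open import Relation.Nullary using (¬_; does)
open import Relation.Binary.PropositionalEquality using (_≡_)
open import Data.Bool using (if_then_else_)
import Algebra.Definitions.RawMonoid as RawMonoidDefs

module _ {c ℓ : Level} (F : CommutativeRing c ℓ) where
  open CommutativeRing F

  private
    module +M = RawMonoidDefs +-rawMonoid

  natF : ℕ → Carrier
  natF n = n +M.× 1#

  ΣF : ∀ {n} → (Fin n → Carrier) → Carrier
  ΣF = +M.sum

  IsField : Set (c ⊔ ℓ)
  IsField = (¬ 1# ≈ 0#) × (∀ x → ¬ x ≈ 0# → ∃ λ y → x * y ≈ 1#)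

  IsFinite : Set (c ⊔ ℓ)
  IsFinite = ∃ λ (q : ℕ) → Σ (Fin q → Carrier) λ e → ∀ x → ∃ λ i → e i ≈ x

  HasCharacteristic : ℕ → Set ℓ
  HasCharacteristic p =
    (0 < p) × (natF p ≈ 0#) × (∀ k → 0 < k → k < p → ¬ natF k ≈ 0#)

  OddCharacteristic : Set ℓ
  OddCharacteristic = ∃ λ p → HasCharacteristic p × (p % 2 ≡ 1)

  δ : ∀ {m} → Fin m → Fin m → Carrier
  δ a x = if does (a ≟ x) then 1# else 0#

  Tensor : ℕ → Set c
  Tensor m = Fin m → Fin m → Fin m → Carrier

  NonZeroT : ∀ {m} → Tensor m → Set ℓ
  NonZeroT T = ∃ λ x → ∃ λ y → ∃ λ z → ¬ T x y z ≈ 0#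

  IsRankOne : ∀ {m} → Tensor m → Set (c ⊔ ℓ)
  IsRankOne {m} T = NonZeroT T ×
    ( (∃ λ (f : Fin m → Carrier) → ∃ λ (g : Fin m → Fin m → Carrier) →
         ∀ x y z → T x y z ≈ f x * g y z)
    ⊎ (∃ λ (f : Fin m → Carrier) → ∃ λ (g : Fin m → Fin m → Carrier) →
         ∀ x y z → T x y z ≈ f y * g x z)
    ⊎ (∃ λ (f : Fin m → Carrier) → ∃ λ (g : Fin m → Fin m → Carrier) →
         ∀ x y z → T x y z ≈ f z * g x y) )

  IsLinComb : ∀ {m} → Tensor m → (r : ℕ) → (Fin r → Carrier) → (Fin r → Tensor m) → Set ℓ
  IsLinComb T r λs R = ∀ x y z → T x y z ≈ ΣF (λ i → λs i * R i x y z)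

  RankAtLeast : ∀ {m} → Tensor m → ℕ → Set (c ⊔ ℓ)
  RankAtLeast T k = ∀ r λs R → (∀ i → IsRankOne (R i)) → IsLinComb T r λs R → k Data.Nat.≤ r

  T₃ : (m : ℕ) → (Fin m → Carrier) → Tensor m
  T₃ m cs x y z = ΣF (λ a →
    (cs a * ((δ a y * δ a z) + ((1# - δ a y) * (1# - δ a z)))) * δ a x)

-- Adding the two functions −c_x (1 − δ_x(y)) and c_x δ_x(z), each depending on only two
-- variables, to T gives the diagonal function 2 c_x δ_x(y) δ_x(z), whose diagonal entries are
-- nonzero in odd characteristic. So it suffices that a diagonal function with m nonzero
-- diagonal entries is not a sum of fewer than m functions f(x_i) g(x_j, x_k). By induction on
-- the number of summands: after permuting the variables the first summand is f(x) g(y, z). If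
-- f vanishes it can be dropped. Otherwise f(a) ≠ 0 for some a, and on the points x, y, z ≠ a
-- the function D(x,y,z) − (f(x)/f(a)) D(a,y,z) is still D, while the same operation kills the
-- first summand and keeps every other summand of the form f(x_i) g(x_j, x_k); this leaves a
-- diagonal function on m − 1 points written with one summand fewer.
module Submission where

open import Defs
open import Level using (Level; _⊔_)
open import Algebra.Bundles using (CommutativeRing)
open import Data.Nat using (ℕ; _∸_; zero; suc; _≤_; _≤?_; z≤n; s≤s)
open import Data.Nat.Properties using (m≤n⇒m≤1+n; ∸-monoˡ-≤)
open import Data.Fin using (Fin; zero; suc; punchIn; _≟_)
open import Data.Fin.Properties using (punchIn-injective; punchInᵢ≢i)
open import Data.Product using (∃; _×_; _,_; proj₁; proj₂)
open import Data.Sum using (_⊎_; inj₁; inj₂)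
open import Data.Empty using (⊥-elim)
open import Function using (_∘_; flip)
open import Relation.Nullary using (¬_; yes; no)
open import Relation.Nullary.Decidable using (dec-true; dec-false; decidable-stable)
open import Relation.Binary.PropositionalEquality as ≡ using (_≡_; _≢_)

¬¬-∀-Fin : ∀ {p n} {P : Fin n → Set p} → (∀ i → ¬ ¬ P i) → ¬ ¬ (∀ i → P i)
¬¬-∀-Fin {n = zero}  _   ¬∀ = ¬∀ (λ ())
¬¬-∀-Fin {n = suc n} ¬¬P ¬∀ =
  ¬¬P zero λ P₀ → ¬¬-∀-Fin (¬¬P ∘ suc) λ P₊ → ¬∀ λ { zero → P₀ ; (suc i) → P₊ i }

module _ {c ℓ : Level} (F : CommutativeRing c ℓ) where
  open CommutativeRing F hiding (zero)
  open import Algebra.Properties.Semiring.Sum semiring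
    using (sum-cong-≋; sum-replicate-zero; sum-remove; ∑-distrib-+; *-distribˡ-sum)
  open import Algebra.Properties.Group +-group using (\\-leftDividesʳ; //-rightDividesˡ)
  open import Algebra.Properties.Ring ring using (-‿distribˡ-*)
  open import Algebra.Solver.Ring.NaturalCoefficients.Default commutativeSemiring
    using (solve; _:+_; _:*_; _:=_)
  open import Relation.Binary.Reasoning.Setoid setoid

  sum-zero : ∀ {n} {u : Fin n → Carrier} → (∀ i → u i ≈ 0#) → ΣF F u ≈ 0#
  sum-zero {n} u≈0 = trans (sum-cong-≋ u≈0) (sum-replicate-zero n)

  sum-+-* : ∀ {n} (u v : Fin n → Carrier) k →
            ΣF F (λ i → u i + k * v i) ≈ ΣF F u + k * ΣF F v
  sum-+-* u v k = trans (∑-distrib-+ u (λ i → k * v i)) (+-congˡ (sym (*-distribˡ-sum k v)))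

  sum-supported : ∀ {n} (u : Fin n → Carrier) x → (∀ a → a ≢ x → u a ≈ 0#) → ΣF F u ≈ u x
  sum-supported {suc n} u x u≈0 = begin
    ΣF F u                     ≈⟨ sum-remove {i = x} u ⟩
    u x + ΣF F (u ∘ punchIn x) ≈⟨ +-congˡ (sum-zero (λ j → u≈0 _ (punchInᵢ≢i x j))) ⟩
    u x + 0#                   ≈⟨ +-identityʳ (u x) ⟩
    u x                        ∎

  δ-diag : ∀ {m} (a : Fin m) → δ F a a ≈ 1#
  δ-diag a rewrite dec-true (a ≟ a) ≡.refl = refl

  δ-off : ∀ {m} {a x : Fin m} → a ≢ x → δ F a x ≈ 0#
  δ-off {a = a} {x} a≢x rewrite dec-false (a ≟ x) a≢x = refl

  agree : Carrier → Carrier → Carrier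
  agree y z = y * z + (1# - y) * (1# - z)

  T₃-value : ∀ {m} (cs : Fin m → Carrier) x y z →
             T₃ F m cs x y z ≈ cs x * agree (δ F x y) (δ F x z)
  T₃-value cs x y z = begin
    T₃ F _ cs x y z       ≈⟨ sum-supported _ x (λ a a≢x → trans (*-congˡ (δ-off a≢x)) (zeroʳ _)) ⟩
    value * δ F x x       ≈⟨ *-congˡ (δ-diag x) ⟩
    value * 1#            ≈⟨ *-identityʳ value ⟩
    value                 ∎
    where value = cs x * agree (δ F x y) (δ F x z)

  corrected-agree : ∀ k y z → - (k * (1# - y)) + (k * z + k * agree y z) ≈ (k + k) * (y * z)
  corrected-agree k y z = begin
    - (k * u) + (k * z + k * (y * z + u * v))
      ≈⟨ +-congˡ (+-congʳ (*-congˡ (sym (*-by-one z (//-rightDividesˡ y 1#))))) ⟩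
    - (k * u) + (k * (z * (u + y)) + k * (y * z + u * v))
      ≈⟨ +-congˡ (expand k y z u v) ⟩
    - (k * u) + (k * (u * (v + z)) + (k + k) * (y * z))
      ≈⟨ +-congˡ (+-congʳ (*-congˡ (*-by-one u (//-rightDividesˡ z 1#)))) ⟩
    - (k * u) + (k * u + (k + k) * (y * z))
      ≈⟨ \\-leftDividesʳ (k * u) _ ⟩
    (k + k) * (y * z) ∎
    where
    u = 1# - y
    v = 1# - z
    *-by-one : ∀ a {b} → b ≈ 1# → a * b ≈ a
    *-by-one a b≈1 = trans (*-congˡ b≈1) (*-identityʳ a)
    expand : ∀ k y z u v →
             k * (z * (u + y)) + k * (y * z + u * v) ≈ k * (u * (v + z)) + (k + k) * (y * z)
    expand = solve 5 (λ k y z u v →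
      k :* (z :* (u :+ y)) :+ k :* (y :* z :+ u :* v) := k :* (u :* (v :+ z)) :+ (k :+ k) :* (y :* z))
      refl

  Factors₁ Factors₂ Factors₃ RankAtMostOne : ∀ {m} → Tensor F m → Set (c ⊔ ℓ)
  Factors₁ {m} T = ∃ λ (f : Fin m → Carrier) → ∃ λ (g : Fin m → Fin m → Carrier) →
                     ∀ x y z → T x y z ≈ f x * g y z
  Factors₂ {m} T = ∃ λ (f : Fin m → Carrier) → ∃ λ (g : Fin m → Fin m → Carrier) →
                     ∀ x y z → T x y z ≈ f y * g x z
  Factors₃ {m} T = ∃ λ (f : Fin m → Carrier) → ∃ λ (g : Fin m → Fin m → Carrier) →
                     ∀ x y z → T x y z ≈ f z * g x y
  RankAtMostOne T = Factors₁ T ⊎ Factors₂ T ⊎ Factors₃ T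

  IsSumOf : ∀ {m r} → Tensor F m → (Fin r → Tensor F m) → Set ℓ
  IsSumOf D P = ∀ x y z → D x y z ≈ ΣF F (λ i → P i x y z)

  IsDiagonal : ∀ {m} → Tensor F m → Set ℓ
  IsDiagonal D = ∀ x y z → ¬ (x ≡ y × x ≡ z) → D x y z ≈ 0#

  diagonalTensor : ∀ {m} → (Fin m → Carrier) → Tensor F m
  diagonalTensor w x y z = w x * (δ F x y * δ F x z)

  diagonalTensor-isDiagonal : ∀ {m} (w : Fin m → Carrier) → IsDiagonal (diagonalTensor w)
  diagonalTensor-isDiagonal w x y z ¬x≡y≡z with x ≟ y
  ... | yes x≡y = trans (*-congˡ (trans (*-congˡ (δ-off λ x≡z → ¬x≡y≡z (x≡y , x≡z))) (zeroʳ _)))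
                        (zeroʳ (w x))
  ... | no _    = trans (*-congˡ (zeroˡ _)) (zeroʳ (w x))

  diagonalTensor-diag : ∀ {m} (w : Fin m → Carrier) x → diagonalTensor w x x x ≈ w x
  diagonalTensor-diag w x = begin
    w x * (δ F x x * δ F x x) ≈⟨ *-congˡ (*-cong (δ-diag x) (δ-diag x)) ⟩
    w x * (1# * 1#)           ≈⟨ *-congˡ (*-identityˡ 1#) ⟩
    w x * 1#                  ≈⟨ *-identityʳ (w x) ⟩
    w x                       ∎

  RankAtMostOne-scale : ∀ {m} {T : Tensor F m} k → RankAtMostOne T →
                        RankAtMostOne (λ x y z → k * T x y z)
  RankAtMostOne-scale k (inj₁ (f , g , T≈fg)) =
    inj₁ ((k *_) ∘ f , g , λ x y z → trans (*-congˡ (T≈fg x y z)) (sym (*-assoc k _ _)))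
  RankAtMostOne-scale k (inj₂ (inj₁ (f , g , T≈fg))) =
    inj₂ (inj₁ ((k *_) ∘ f , g , λ x y z → trans (*-congˡ (T≈fg x y z)) (sym (*-assoc k _ _))))
  RankAtMostOne-scale k (inj₂ (inj₂ (f , g , T≈fg))) =
    inj₂ (inj₂ ((k *_) ∘ f , g , λ x y z → trans (*-congˡ (T≈fg x y z)) (sym (*-assoc k _ _))))

  swap₁₂ swap₁₃ : ∀ {m} → Tensor F m → Tensor F m
  swap₁₂ T x y z = T y x z
  swap₁₃ T x y z = T z y x

  RankAtMostOne-swap₁₂ : ∀ {m} {T : Tensor F m} → RankAtMostOne T → RankAtMostOne (swap₁₂ T)
  RankAtMostOne-swap₁₂ (inj₁ (f , g , T≈fg)) = inj₂ (inj₁ (f , g , λ x y z → T≈fg y x z))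
  RankAtMostOne-swap₁₂ (inj₂ (inj₁ (f , g , T≈fg))) = inj₁ (f , g , λ x y z → T≈fg y x z)
  RankAtMostOne-swap₁₂ (inj₂ (inj₂ (f , g , T≈fg))) = inj₂ (inj₂ (f , flip g , λ x y z → T≈fg y x z))

  RankAtMostOne-swap₁₃ : ∀ {m} {T : Tensor F m} → RankAtMostOne T → RankAtMostOne (swap₁₃ T)
  RankAtMostOne-swap₁₃ (inj₁ (f , g , T≈fg)) = inj₂ (inj₂ (f , flip g , λ x y z → T≈fg z y x))
  RankAtMostOne-swap₁₃ (inj₂ (inj₁ (f , g , T≈fg))) = inj₂ (inj₁ (f , flip g , λ x y z → T≈fg z y x))
  RankAtMostOne-swap₁₃ (inj₂ (inj₂ (f , g , T≈fg))) = inj₁ (f , flip g , λ x y z → T≈fg z y x)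

  IsDiagonal-swap₁₂ : ∀ {m} {D : Tensor F m} → IsDiagonal D → IsDiagonal (swap₁₂ D)
  IsDiagonal-swap₁₂ diag x y z ¬x≡y≡z =
    diag y x z λ { (≡.refl , ≡.refl) → ¬x≡y≡z (≡.refl , ≡.refl) }

  IsDiagonal-swap₁₃ : ∀ {m} {D : Tensor F m} → IsDiagonal D → IsDiagonal (swap₁₃ D)
  IsDiagonal-swap₁₃ diag x y z ¬x≡y≡z =
    diag z y x λ { (≡.refl , ≡.refl) → ¬x≡y≡z (≡.refl , ≡.refl) }

  IsSumOf-drop : ∀ {m r} {D : Tensor F m} {P : Fin (suc r) → Tensor F m} →
                 (∀ x y z → P zero x y z ≈ 0#) → IsSumOf D P → IsSumOf D (P ∘ suc)
  IsSumOf-drop P₀≈0 D≈ΣP x y z =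
    trans (D≈ΣP x y z) (trans (+-congʳ (P₀≈0 x y z)) (+-identityˡ _))

  restrict : ∀ {m n} → (Fin n → Fin m) → Tensor F m → Tensor F n
  restrict ι T x y z = T (ι x) (ι y) (ι z)

  IsDiagonal-restrict : ∀ {m n} {ι : Fin n → Fin m} {D : Tensor F m} →
                        (∀ {x y} → ι x ≡ ι y → x ≡ y) → IsDiagonal D → IsDiagonal (restrict ι D)
  IsDiagonal-restrict ι-injective diag x y z ¬x≡y≡z =
    diag _ _ _ λ { (ιx≡ιy , ιx≡ιz) → ¬x≡y≡z (ι-injective ιx≡ιy , ι-injective ιx≡ιz) }

  eliminate : ∀ {m n} → (Fin n → Fin m) → Fin m → (Fin n → Carrier) → Tensor F m → Tensor F n
  eliminate ι a k T x y z = restrict ι T x y z + k x * T a (ι y) (ι z)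

  +-*-factorʳ : ∀ p q r k → p * r + k * (q * r) ≈ (p + k * q) * r
  +-*-factorʳ = solve 4 (λ p q r k → p :* r :+ k :* (q :* r) := (p :+ k :* q) :* r) refl

  +-*-factorˡ : ∀ p q r k → p * q + k * (p * r) ≈ p * (q + k * r)
  +-*-factorˡ = solve 4 (λ p q r k → p :* q :+ k :* (p :* r) := p :* (q :+ k :* r)) refl

  RankAtMostOne-eliminate : ∀ {m n} {T : Tensor F m} (ι : Fin n → Fin m) a k →
                            RankAtMostOne T → RankAtMostOne (eliminate ι a k T)
  RankAtMostOne-eliminate ι a k (inj₁ (f , g , T≈fg)) =
    inj₁ ((λ x → f (ι x) + k x * f a) , (λ y z → g (ι y) (ι z)) ,
          λ x y z → trans (+-cong (T≈fg _ _ _) (*-congˡ (T≈fg _ _ _))) (+-*-factorʳ _ _ _ _))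
  RankAtMostOne-eliminate ι a k (inj₂ (inj₁ (f , g , T≈fg))) =
    inj₂ (inj₁ (f ∘ ι , (λ x z → g (ι x) (ι z) + k x * g a (ι z)) ,
          λ x y z → trans (+-cong (T≈fg _ _ _) (*-congˡ (T≈fg _ _ _))) (+-*-factorˡ _ _ _ _)))
  RankAtMostOne-eliminate ι a k (inj₂ (inj₂ (f , g , T≈fg))) =
    inj₂ (inj₂ (f ∘ ι , (λ x y → g (ι x) (ι y) + k x * g a (ι y)) ,
          λ x y z → trans (+-cong (T≈fg _ _ _) (*-congˡ (T≈fg _ _ _))) (+-*-factorˡ _ _ _ _)))

  IsSumOf-eliminate : ∀ {m n r} {D : Tensor F m} {P : Fin r → Tensor F m} (ι : Fin n → Fin m) a k →
                      IsSumOf D P → IsSumOf (eliminate ι a k D) (λ i → eliminate ι a k (P i))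
  IsSumOf-eliminate {P = P} ι a k D≈ΣP x y z =
    trans (+-cong (D≈ΣP _ _ _) (*-congˡ (D≈ΣP _ _ _)))
          (sym (sum-+-* (λ i → P i (ι x) (ι y) (ι z)) (λ i → P i a (ι y) (ι z)) (k x)))

  eliminate-diagonal : ∀ {m n} {D : Tensor F m} (ι : Fin n → Fin m) a k → (∀ j → ι j ≢ a) →
                       IsDiagonal D → ∀ x y z → eliminate ι a k D x y z ≈ restrict ι D x y z
  eliminate-diagonal ι a k ι≢a diag x y z =
    trans (+-congˡ (trans (*-congˡ (diag a (ι y) (ι z) λ (a≡ιy , _) → ι≢a y (≡.sym a≡ιy)))
                          (zeroʳ (k x))))
          (+-identityʳ _)

  eliminate-Factors₁ : ∀ {m n} {T : Tensor F m} (ι : Fin n → Fin m) {a w}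
                       (f : Fin m → Carrier) (g : Fin m → Fin m → Carrier) →
                       f a * w ≈ 1# → (∀ x y z → T x y z ≈ f x * g y z) →
                       ∀ x y z → eliminate ι a (λ x → - (f (ι x) * w)) T x y z ≈ 0#
  eliminate-Factors₁ {T = T} ι {a} {w} f g faw≈1 T≈fg x y z = begin
    restrict ι T x y z + - (p * w) * T a (ι y) (ι z) ≈⟨ +-cong (T≈fg _ _ _) (*-congˡ (T≈fg _ _ _)) ⟩
    p * q + - (p * w) * (f a * q)                   ≈⟨ +-congˡ (sym (-‿distribˡ-* _ _)) ⟩
    p * q + - ((p * w) * (f a * q))                 ≈⟨ +-congˡ (-‿cong (regroup p w (f a) q)) ⟩
    p * q + - (p * ((f a * w) * q))                 ≈⟨ +-congˡ (-‿cong (*-congˡ (*-congʳ faw≈1))) ⟩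
    p * q + - (p * (1# * q))                        ≈⟨ +-congˡ (-‿cong (*-congˡ (*-identityˡ q))) ⟩
    p * q + - (p * q)                               ≈⟨ -‿inverseʳ (p * q) ⟩
    0#                                              ∎
    where
    p = f (ι x)
    q = g (ι y) (ι z)
    regroup : ∀ p w s q → (p * w) * (s * q) ≈ p * ((s * w) * q)
    regroup = solve 4 (λ p w s q → (p :* w) :* (s :* q) := p :* ((s :* w) :* q)) refl

  DiagonalRankBound : ℕ → Set (c ⊔ ℓ)
  DiagonalRankBound r = ∀ {m} {D : Tensor F m} (P : Fin r → Tensor F m) →
    (∀ i → RankAtMostOne (P i)) → IsSumOf D P → IsDiagonal D → (∀ x → ¬ D x x x ≈ 0#) → m ≤ r

  diagonal-rank-step : IsField F → ∀ {r} → DiagonalRankBound r →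
    ∀ {m} {D : Tensor F (suc m)} (P : Fin (suc r) → Tensor F (suc m)) →
    (∀ i → RankAtMostOne (P i)) → IsSumOf D P → IsDiagonal D → (∀ x → ¬ D x x x ≈ 0#) →
    Factors₁ (P zero) → suc m ≤ suc r
  diagonal-rank-step isField {r} bound {m} {D} P shapes D≈ΣP diag nz (f , g , P₀≈fg) =
    -- Equality in F need not be decidable, but the conclusion is, so we may argue
    -- by cases on whether f vanishes identically.
    decidable-stable (suc m ≤? suc r) λ ¬goal →
      ¬¬-∀-Fin (λ a fa≉0 → ¬goal (eliminate-at a fa≉0)) (¬goal ∘ drop-first)
    where
    drop-first : (∀ a → f a ≈ 0#) → suc m ≤ suc r
    drop-first f≈0 =
      m≤n⇒m≤1+n (bound (P ∘ suc) (shapes ∘ suc) (IsSumOf-drop {P = P} P₀≈0 D≈ΣP) diag nz)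
      where
      P₀≈0 : ∀ x y z → P zero x y z ≈ 0#
      P₀≈0 x y z = trans (P₀≈fg x y z) (trans (*-congʳ (f≈0 x)) (zeroˡ _))

    eliminate-at : ∀ a → ¬ f a ≈ 0# → suc m ≤ suc r
    eliminate-at a fa≉0 = s≤s (bound (λ i → eliminate ι a k (P (suc i)))
      (λ i → RankAtMostOne-eliminate ι a k (shapes (suc i))) restricted-sum
      (IsDiagonal-restrict (punchIn-injective a _ _) diag) (nz ∘ ι))
      where
      ι = punchIn a
      inverse = proj₂ isField (f a) fa≉0
      k = λ x → - (f (ι x) * proj₁ inverse)
      restricted-sum : IsSumOf (restrict ι D) (λ i → eliminate ι a k (P (suc i)))
      restricted-sum =
        IsSumOf-drop {P = eliminate ι a k ∘ P} (eliminate-Factors₁ ι f g (proj₂ inverse) P₀≈fg)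
        λ x y z → trans (sym (eliminate-diagonal ι a k (punchInᵢ≢i a) diag x y z))
                        (IsSumOf-eliminate {P = P} ι a k D≈ΣP x y z)

  diagonal-rank : IsField F → ∀ r → DiagonalRankBound r
  diagonal-rank _       zero    {zero}  _ _ _    _ _  = z≤n
  diagonal-rank _       zero    {suc m} _ _ D≈ΣP _ nz = ⊥-elim (nz zero (D≈ΣP zero zero zero))
  diagonal-rank _       (suc r) {zero}  _ _ _    _ _  = z≤n
  diagonal-rank isField (suc r) {suc m} {D} P shapes D≈ΣP diag nz with shapes zero
  ... | inj₁ P₀≈fg =
    diagonal-rank-step isField (diagonal-rank isField r) P shapes D≈ΣP diag nz P₀≈fg
  ... | inj₂ (inj₁ (f , g , P₀≈fg)) =
    diagonal-rank-step isField (diagonal-rank isField r) {D = swap₁₂ D} (swap₁₂ ∘ P)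
      (RankAtMostOne-swap₁₂ ∘ shapes) (λ x y z → D≈ΣP y x z) (IsDiagonal-swap₁₂ diag) nz
      (f , g , λ x y z → P₀≈fg y x z)
  ... | inj₂ (inj₂ (f , g , P₀≈fg)) =
    diagonal-rank-step isField (diagonal-rank isField r) {D = swap₁₃ D} (swap₁₃ ∘ P)
      (RankAtMostOne-swap₁₃ ∘ shapes) (λ x y z → D≈ΣP z y x) (IsDiagonal-swap₁₃ diag) nz
      (f , flip g , λ x y z → P₀≈fg z y x)

  1+1≉0 : IsField F → OddCharacteristic F → ¬ 1# + 1# ≈ 0#
  1+1≉0 _ (zero , (() , _) , _)
  1+1≉0 (1≉0 , _) (suc zero , (_ , 1+0≈0 , _) , _) _ = 1≉0 (trans (sym (+-identityʳ 1#)) 1+0≈0)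
  1+1≉0 _ (suc (suc zero) , _ , ())
  1+1≉0 _ (suc (suc (suc p)) , (_ , _ , below-p≉0) , _) 1+1≈0 =
    below-p≉0 2 (s≤s z≤n) (s≤s (s≤s (s≤s z≤n))) (trans (+-congˡ (+-identityʳ 1#)) 1+1≈0)

  x+x≉0 : IsField F → OddCharacteristic F → ∀ {x} → ¬ x ≈ 0# → ¬ x + x ≈ 0#
  x+x≉0 isField odd {x} x≉0 x+x≈0 with proj₂ isField x x≉0
  ... | w , xw≈1 = 1+1≉0 isField odd (begin
    1# + 1#               ≈⟨ *-identityʳ _ ⟨
    (1# + 1#) * 1#        ≈⟨ *-congˡ xw≈1 ⟨
    (1# + 1#) * (x * w)   ≈⟨ *-assoc _ x w ⟨
    (1# + 1#) * x * w     ≈⟨ *-congʳ (distribʳ x 1# 1#) ⟩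
    (1# * x + 1# * x) * w ≈⟨ *-congʳ (+-cong (*-identityˡ x) (*-identityˡ x)) ⟩
    (x + x) * w           ≈⟨ *-congʳ x+x≈0 ⟩
    0# * w                ≈⟨ zeroˡ w ⟩
    0#                    ∎)

  T₃-rank-bound : IsField F → OddCharacteristic F → ∀ {m} (cs : Fin m → Carrier) →
    (∀ a → ¬ cs a ≈ 0#) → ∀ r λs R → (∀ i → IsRankOne F (R i)) →
    IsLinComb F (T₃ F m cs) r λs R → m ≤ suc (suc r)
  T₃-rank-bound isField odd {m} cs cs≉0 r λs R rankOne T≈ΣλR =
    diagonal-rank isField (suc (suc r)) Q shapes D≈ΣQ (diagonalTensor-isDiagonal w)
      (λ x → x+x≉0 isField odd (cs≉0 x) ∘ trans (sym (diagonalTensor-diag w x)))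
    where
    w = λ x → cs x + cs x
    Q : Fin (suc (suc r)) → Tensor F m
    Q zero          x y z = - (cs x * (1# - δ F x y))
    Q (suc zero)    x y z = cs x * δ F x z
    Q (suc (suc i)) x y z = λs i * R i x y z
    shapes : ∀ i → RankAtMostOne (Q i)
    shapes zero          = inj₂ (inj₂ ((λ _ → 1#) , _ , λ _ _ _ → sym (*-identityˡ _)))
    shapes (suc zero)    = inj₂ (inj₁ ((λ _ → 1#) , _ , λ _ _ _ → sym (*-identityˡ _)))
    shapes (suc (suc i)) = RankAtMostOne-scale (λs i) (proj₂ (rankOne i))
    D≈ΣQ : IsSumOf (diagonalTensor w) Q
    D≈ΣQ x y z = trans (sym (corrected-agree (cs x) (δ F x y) (δ F x z)))
                       (+-congˡ (+-congˡ (trans (sym (T₃-value cs x y z)) (T≈ΣλR x y z))))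

lemma3 : ∀ {c ℓ : Level} (F : CommutativeRing c ℓ) →
    IsField F → IsFinite F → OddCharacteristic F →
    (m : ℕ) (cs : Fin m → CommutativeRing.Carrier F) →
    (∀ a → ¬ CommutativeRing._≈_ F (cs a) (CommutativeRing.0# F)) →
    RankAtLeast F (T₃ F m cs) (m ∸ 2)
lemma3 F isField _ odd m cs cs≉0 r λs R rankOne T≈ΣλR =
  ∸-monoˡ-≤ 2 (T₃-rank-bound F isField odd cs cs≉0 r λs R rankOne T≈ΣλR)
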